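{- For $n\ge 2$ let $f_n(t)=g_{n,\lfloor n/2\rfloor}(t)$, where $$g_{n,d}(t)=\sum_{i=1}^{\min(d,n-d)} \frac{(n-i-1)!}{(d-i)!\,(n-d-i)!\,(i-1)!}\, t^i,$$ and for $n\ge 3$ let $r_n(t)=f_{n-1}(t)/f_n(t)$. Then $\lim_{n\to+\infty} r_n(1)=\sqrt{2}-1$.
   Context: $g_{n,d}$ is Speyer's $g$-polynomial of the uniform matroid $U_{n,d}$. -}

module Defs where

open import Data.Nat as ℕ using (ℕ; zero; suc; _∸_; _!; _⊓_)
open import Data.Nat.Properties using (_!≢0; m*n≢0)
open import Data.Integer using (+_)
open import Data.Rational using (ℚ; 0ℚ; 1ℚ; _+_; _*_; _÷_; _/_; _<_; ≢-nonZero)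
open import Data.Rational.Properties using (_≟_)
open import Relation.Nullary using (yes; no)

_^ℚ_ : ℚ → ℕ → ℚ
q ^ℚ zero  = 1ℚ
q ^ℚ suc k = q * (q ^ℚ k)

sum1 : ℕ → (ℕ → ℚ) → ℚ
sum1 zero    f = 0ℚ
sum1 (suc m) f = sum1 m f + f (suc m)

coeff : ℕ → ℕ → ℕ → ℚ
coeff n d i =
  _/_ (+ ((n ∸ i ∸ 1) !)) ((d ∸ i) ! ℕ.* (n ∸ d ∸ i) ! ℕ.* (i ∸ 1) !)
    {{m*n≢0 _ _ {{m*n≢0 _ _ {{(d ∸ i) !≢0}} {{(n ∸ d ∸ i) !≢0}}}} {{(i ∸ 1) !≢0}}}}

g : ℕ → ℕ → ℚ → ℚ
g n d t = sum1 (d ⊓ (n ∸ d)) (λ i → coeff n d i * (t ^ℚ i))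

f : ℕ → ℚ → ℚ
f n t = g n (n ℕ./ 2) t

-- total division on ℚ (p / 0 := 0; only used where the denominator is
-- nonzero, namely f_n(1) > 0 for n ≥ 2)
_÷'_ : ℚ → ℚ → ℚ
p ÷' q with q ≟ 0ℚ
... | yes _  = 0ℚ
... | no q≢0 = _÷_ p q {{≢-nonZero q≢0}}

r : ℕ → ℚ → ℚ
r n t = f (n ∸ 1) t ÷' f n t

-- Dedekind cut of √2 - 1 over ℚ:
-- a < √2 - 1  iff  a + 1 < 0  or  (a + 1)^2 < 2
BelowSqrt2Minus1 : ℚ → Set
BelowSqrt2Minus1 a = (a + 1ℚ < 0ℚ) ⊎ ((a + 1ℚ) * (a + 1ℚ) < 1ℚ + 1ℚ)
  where open import Data.Sum using (_⊎_)

-- √2 - 1 < b  iff  0 < b + 1  and  2 < (b + 1)^2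
AboveSqrt2Minus1 : ℚ → Set
AboveSqrt2Minus1 b = (0ℚ < b + 1ℚ) × (1ℚ + 1ℚ < (b + 1ℚ) * (b + 1ℚ))
  where open import Data.Product using (_×_)

-- a sequence x of rationals converges (in ℝ) to √2 - 1:
-- for all rationals a < √2 - 1 < b, eventually a < x n < b
ConvergesToSqrt2Minus1 : (ℕ → ℚ) → Set
ConvergesToSqrt2Minus1 x =
  (a b : ℚ) → BelowSqrt2Minus1 a → AboveSqrt2Minus1 b →
  Σ ℕ (λ N → (n : ℕ) → N ℕ.≤ n → (a < x n) × (x n < b))
  where open import Data.Product using (Σ; _×_)

-- With A = d - 1 and B = n - d - 1, the coefficients of g_{n,d}(1) are the trinomial coefficients
-- (A + B - j)! / ((A - j)! (B - j)! j!), whose sum is the Delannoy number D(A, B).  So f_{2m+2}(1) = D(m, m),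
-- f_{2m+3}(1) = D(m, m+1), and r_n(1) = y/z runs through the ratios of consecutive terms of
-- D(0,0), D(0,1), D(1,1), D(1,2), ...  How far (y/z + 1)^2 is from 2 is measured by the norm
-- N = (y + z)^2 - 2 z^2 of (y + z) + z√2.  The recurrence D(m+1, m+1) = 2 D(m, m+1) + D(m, m) multiplies
-- (y + z) + z√2 by the unit 1 + √2, so |N| is unchanged while z^2 grows at least fourfold; the recurrence
-- (m+1) D(m, m+1) = (2m+1) D(m, m) + m D(m-1, m) gives (m+1)^2 N' = (4m+2) z^2 - m^2 N for the next norm N'.
-- By induction c |N| <= 10 z^2 with c growing linearly in n, i.e. |(r_n(1) + 1)^2 - 2| <= 10/c.

module Submission where

open import Defs
open import Data.Rational using (1ℚ)


module Multinomial where

  open import Data.Nat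
  open import Data.Nat.Properties
  open import Data.Nat.Combinatorics using (_C_; nCk≡n!/k![n-k]!; k![n∸k]!∣n!)
  open import Data.Nat.DivMod using (m/n*n≡m)
  open import Data.Nat.Tactic.RingSolver using (solve-∀)
  open import Relation.Binary.PropositionalEquality
  open ≡-Reasoning

  binomial-! : ∀ a b → ((a + b) C a) * (a ! * b !) ≡ (a + b) !
  binomial-! a b = subst (λ c → ((a + b) C a) * (a ! * c !) ≡ (a + b) !) (m+n∸m≡n a b)
    (trans (cong (_* (a ! * (a + b ∸ a) !)) (nCk≡n!/k![n-k]! (m≤m+n a b)))
           (m/n*n≡m {{a !* (a + b ∸ a) !≢0}} (k![n∸k]!∣n! (m≤m+n a b))))

  multinomial : ℕ → ℕ → ℕ → ℕ
  multinomial x y z = ((x + (y + z)) C x) * ((y + z) C y)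

  multinomial-! : ∀ x y z → multinomial x y z * (x ! * y ! * z !) ≡ (x + y + z) !
  multinomial-! x y z = begin
    P * Q * (x ! * y ! * z !)      ≡⟨ regroup P Q (x !) (y !) (z !) ⟩
    P * (x ! * (Q * (y ! * z !)))  ≡⟨ cong (λ u → P * (x ! * u)) (binomial-! y z) ⟩
    P * (x ! * (y + z) !)          ≡⟨ binomial-! x (y + z) ⟩
    (x + (y + z)) !                ≡⟨ cong _! (+-assoc x y z) ⟨
    (x + y + z) !                  ∎
    where
    P = (x + (y + z)) C x
    Q = (y + z) C y
    regroup : ∀ p q a b c → p * q * (a * b * c) ≡ p * (a * (q * (b * c)))
    regroup = solve-∀

  multinomial-pos : ∀ x y z → 0 < multinomial x y z
  multinomial-pos x y z = n≢0⇒n>0 λ m≡0 →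
    ≢-nonZero⁻¹ ((x + y + z) !) {{(x + y + z) !≢0}}
      (trans (sym (multinomial-! x y z)) (cong (_* (x ! * y ! * z !)) m≡0))

  cancel-factorials : ∀ {a b} x y z → a * (x ! * y ! * z !) ≡ b * (x ! * y ! * z !) → a ≡ b
  cancel-factorials {a} {b} x y z = *-cancelʳ-≡ a b _ {{m*n≢0 _ _ {{x !* y !≢0}} {{z !≢0}}}}

  multinomial-sucˡ : ∀ x y z → suc x * multinomial (suc x) y z ≡ suc (x + y + z) * multinomial x y z
  multinomial-sucˡ x y z = cancel-factorials x y z (begin
    suc x * M′ * (x ! * y ! * z !)      ≡⟨ regroup M′ (x !) (y !) (z !) x ⟩
    M′ * (suc x ! * y ! * z !)          ≡⟨ multinomial-! (suc x) y z ⟩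
    suc (x + y + z) !                   ≡⟨ cong (suc (x + y + z) *_) (multinomial-! x y z) ⟨
    suc (x + y + z) * (multinomial x y z * (x ! * y ! * z !))
                                        ≡⟨ *-assoc (suc (x + y + z)) (multinomial x y z) (x ! * y ! * z !) ⟨
    suc (x + y + z) * multinomial x y z * (x ! * y ! * z !) ∎)
    where
    M′ = multinomial (suc x) y z
    regroup : ∀ m a b c x → suc x * m * (a * b * c) ≡ m * ((a + x * a) * b * c)
    regroup = solve-∀

  multinomial-sucʳ : ∀ x y z → suc z * multinomial x y (suc z) ≡ suc (x + y + z) * multinomial x y z
  multinomial-sucʳ x y z = cancel-factorials x y z (begin
    suc z * M′ * (x ! * y ! * z !)      ≡⟨ regroup M′ (x !) (y !) (z !) z ⟩
    M′ * (x ! * y ! * suc z !)          ≡⟨ multinomial-! x y (suc z) ⟩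
    (x + y + suc z) !                   ≡⟨ cong _! (+-suc (x + y) z) ⟩
    suc (x + y + z) !                   ≡⟨ cong (suc (x + y + z) *_) (multinomial-! x y z) ⟨
    suc (x + y + z) * (multinomial x y z * (x ! * y ! * z !))
                                        ≡⟨ *-assoc (suc (x + y + z)) (multinomial x y z) (x ! * y ! * z !) ⟨
    suc (x + y + z) * multinomial x y z * (x ! * y ! * z !) ∎)
    where
    M′ = multinomial x y (suc z)
    regroup : ∀ m a b c z → suc z * m * (a * b * c) ≡ m * (a * b * (c + z * c))
    regroup = solve-∀

  multinomial-swap : ∀ x y z → multinomial x y z ≡ multinomial y x z
  multinomial-swap x y z = cancel-factorials x y z (begin
    multinomial x y z * (x ! * y ! * z !)   ≡⟨ multinomial-! x y z ⟩
    (x + y + z) !                           ≡⟨ cong (λ u → (u + z) !) (+-comm x y) ⟩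
    (y + x + z) !                           ≡⟨ multinomial-! y x z ⟨
    multinomial y x z * (y ! * x ! * z !)   ≡⟨ cong (λ u → multinomial y x z * (u * z !)) (*-comm (y !) (x !)) ⟩
    multinomial y x z * (x ! * y ! * z !)   ∎)


module FiniteSums where

  open import Data.Nat
  open import Data.Nat.Properties
  open import Data.Nat.Tactic.RingSolver using (solve-∀)
  open import Relation.Binary.PropositionalEquality
  open ≡-Reasoning

  sumTo : ℕ → (ℕ → ℕ) → ℕ
  sumTo zero    f = 0
  sumTo (suc K) f = sumTo K f + f K

  sumTo-cong : ∀ K {f g : ℕ → ℕ} → (∀ j → f j ≡ g j) → sumTo K f ≡ sumTo K g
  sumTo-cong zero    f≗g = refl
  sumTo-cong (suc K) f≗g = cong₂ _+_ (sumTo-cong K f≗g) (f≗g K)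

  sumTo-vanishing-tail : ∀ K L (f : ℕ → ℕ) → (∀ j → K ≤ j → f j ≡ 0) → sumTo (K + L) f ≡ sumTo K f
  sumTo-vanishing-tail K zero    f tail = cong (λ n → sumTo n f) (+-identityʳ K)
  sumTo-vanishing-tail K (suc L) f tail = begin
    sumTo (K + suc L) f              ≡⟨ cong (λ n → sumTo n f) (+-suc K L) ⟩
    sumTo (K + L) f + f (K + L)      ≡⟨ cong₂ _+_ (sumTo-vanishing-tail K L f tail) (tail (K + L) (m≤m+n K L)) ⟩
    sumTo K f + 0                    ≡⟨ +-identityʳ _ ⟩
    sumTo K f                        ∎

  shift : (ℕ → ℕ) → ℕ → ℕ
  shift f zero    = 0
  shift f (suc j) = f j

  sumTo-shift : ∀ K f → sumTo (suc K) (shift f) ≡ sumTo K f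
  sumTo-shift zero    f = refl
  sumTo-shift (suc K) f = cong (_+ f K) (sumTo-shift K f)

  sumTo-distrib-+ : ∀ K (f g : ℕ → ℕ) → sumTo K (λ j → f j + g j) ≡ sumTo K f + sumTo K g
  sumTo-distrib-+ zero    f g = refl
  sumTo-distrib-+ (suc K) f g = begin
    sumTo K (λ j → f j + g j) + (f K + g K)   ≡⟨ cong (_+ (f K + g K)) (sumTo-distrib-+ K f g) ⟩
    sumTo K f + sumTo K g + (f K + g K)       ≡⟨ +-+-comm (sumTo K f) (sumTo K g) (f K) (g K) ⟩
    sumTo K f + f K + (sumTo K g + g K)       ∎
    where
    +-+-comm : ∀ a b c d → a + b + (c + d) ≡ a + c + (b + d)
    +-+-comm = solve-∀

  *-distribˡ-sumTo : ∀ K c (f : ℕ → ℕ) → c * sumTo K f ≡ sumTo K (λ j → c * f j)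
  *-distribˡ-sumTo zero    c f = *-zeroʳ c
  *-distribˡ-sumTo (suc K) c f = trans (*-distribˡ-+ c (sumTo K f) (f K)) (cong (_+ c * f K) (*-distribˡ-sumTo K c f))


module Delannoy where

  open import Data.Nat
  open import Data.Nat.Properties
  open import Data.Nat.Tactic.RingSolver using (solve-∀)
  open import Data.Product using (_,_)
  open import Data.Sum using (inj₁; inj₂)
  open import Relation.Binary.PropositionalEquality
  open import Relation.Nullary using (yes; no; contradiction)
  open ≡-Reasoning
  open Multinomial
  open FiniteSums

  -- D(A, B) = Σ_{j ≤ min(A,B)} (A + B - j)! / ((A - j)! (B - j)! j!); the term is set to 0 beyond min(A, B)
  -- so that sums of it may run over any longer range
  term : ℕ → ℕ → ℕ → ℕ
  term A B j with j ≤? A ⊓ B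
  ... | yes _ = multinomial (A ∸ j) (B ∸ j) j
  ... | no  _ = 0

  term-≤ : ∀ {A B j} → j ≤ A ⊓ B → term A B j ≡ multinomial (A ∸ j) (B ∸ j) j
  term-≤ {A} {B} {j} j≤ with j ≤? A ⊓ B
  ... | yes _ = refl
  ... | no j≰ = contradiction j≤ j≰

  term-> : ∀ {A B j} → A ⊓ B < j → term A B j ≡ 0
  term-> {A} {B} {j} lt with j ≤? A ⊓ B
  ... | yes j≤ = contradiction j≤ (<⇒≱ lt)
  ... | no _   = refl

  term-+ : ∀ j x y → term (j + x) (j + y) j ≡ multinomial x y j
  term-+ j x y = trans (term-≤ (⊓-glb (m≤m+n j x) (m≤m+n j y)))
                       (cong₂ (λ u v → multinomial u v j) (m+n∸m≡n j x) (m+n∸m≡n j y))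

  term-comm : ∀ A B j → term A B j ≡ term B A j
  term-comm A B j with ≤-<-connex j (A ⊓ B)
  ... | inj₁ j≤ = trans (term-≤ j≤) (trans (multinomial-swap (A ∸ j) (B ∸ j) j)
                                           (sym (term-≤ (subst (j ≤_) (⊓-comm A B) j≤))))
  ... | inj₂ j> = trans (term-> j>) (sym (term-> (subst (_< j) (⊓-comm A B) j>)))

  delannoy : ℕ → ℕ → ℕ
  delannoy A B = sumTo (suc (A ⊓ B)) (term A B)

  delannoy-sumTo : ∀ {A B K} → A ⊓ B < K → sumTo K (term A B) ≡ delannoy A B
  delannoy-sumTo {A} {B} {K} lt with m≤n⇒∃[o]m+o≡n lt
  ... | L , refl = sumTo-vanishing-tail (suc (A ⊓ B)) L (term A B) (λ j → term->)

  delannoy-comm : ∀ A B → delannoy A B ≡ delannoy B A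
  delannoy-comm A B = begin
    sumTo (suc (A ⊓ B)) (term A B)   ≡⟨ sumTo-cong (suc (A ⊓ B)) (term-comm A B) ⟩
    sumTo (suc (A ⊓ B)) (term B A)   ≡⟨ cong (λ K → sumTo (suc K) (term B A)) (⊓-comm A B) ⟩
    sumTo (suc (B ⊓ A)) (term B A)   ∎

  delannoy-pos : ∀ A B → 0 < delannoy A B
  delannoy-pos A B = <-≤-trans (multinomial-pos A B 0) (≤-trans (≤-reflexive (sym (term-+ 0 A B))) (first≤sum {A ⊓ B}))
    where
    first≤sum : ∀ {K} → term A B 0 ≤ sumTo (suc K) (term A B)
    first≤sum {zero}  = ≤-refl
    first≤sum {suc K} = ≤-trans (first≤sum {K}) (m≤m+n _ _)

  -- The termwise form of delannoy-recurrence: with M = multinomial, P = M x y (1 + i), T₁ = M (x - 1) y (1 + i)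
  -- and T₂ = M x y i.  Multiplying by the common denominator x + y + i + 1 makes it a polynomial identity.
  weighted-pascal : ∀ {P T₁ T₂} i x y → suc (x + y + i) * T₁ ≡ x * P → suc (x + y + i) * T₂ ≡ suc i * P →
                    suc (i + x) * P ≡ (suc (i + x) + suc (i + y)) * T₁ + suc (i + y) * T₂
  weighted-pascal {P} {T₁} {T₂} i x y e₁ e₂ = *-cancelˡ-≡ _ _ N (begin
    N * (suc (i + x) * P)                                    ≡⟨ polynomial i x y P ⟩
    (suc (i + x) + suc (i + y)) * (x * P) + suc (i + y) * (suc i * P)
                                                   ≡⟨ cong₂ (λ u v → (suc (i + x) + suc (i + y)) * u + suc (i + y) * v) e₁ e₂ ⟨
    (suc (i + x) + suc (i + y)) * (N * T₁) + suc (i + y) * (N * T₂)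
                                                             ≡⟨ factor N (suc (i + x) + suc (i + y)) (suc (i + y)) T₁ T₂ ⟩
    N * ((suc (i + x) + suc (i + y)) * T₁ + suc (i + y) * T₂) ∎)
    where
    N = suc (x + y + i)
    polynomial : ∀ i x y P → suc (x + y + i) * (suc (i + x) * P) ≡
                 (suc (i + x) + suc (i + y)) * (x * P) + suc (i + y) * (suc i * P)
    polynomial = solve-∀
    factor : ∀ n a b s t → a * (n * s) + b * (n * t) ≡ n * (a * s + b * t)
    factor = solve-∀

  term-below : ∀ i x y → suc (x + y + i) * term (i + x) (suc (i + y)) (suc i) ≡ x * multinomial x y (suc i)
  term-below i zero y = begin
    suc (y + i) * term (i + 0) (suc (i + y)) (suc i)   ≡⟨ cong (suc (y + i) *_) (term-> i+0⊓<) ⟩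
    suc (y + i) * 0                                    ≡⟨ *-zeroʳ (suc (y + i)) ⟩
    0                                                  ∎
    where
    i+0⊓< : (i + 0) ⊓ suc (i + y) < suc i
    i+0⊓< = s≤s (≤-trans (m⊓n≤m (i + 0) _) (≤-reflexive (+-identityʳ i)))
  term-below i (suc x) y = begin
    suc (suc x + y + i) * term (i + suc x) (suc (i + y)) (suc i)
      ≡⟨ cong₂ (λ u v → suc u * term v (suc (i + y)) (suc i)) (sym (+-suc (x + y) i)) (+-suc i x) ⟩
    suc (x + y + suc i) * term (suc i + x) (suc i + y) (suc i)
      ≡⟨ cong (suc (x + y + suc i) *_) (term-+ (suc i) x y) ⟩
    suc (x + y + suc i) * multinomial x y (suc i)
      ≡⟨ multinomial-sucˡ x y (suc i) ⟨
    suc x * multinomial (suc x) y (suc i) ∎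

  private
    vanishing : ∀ {u v w} c d e → u ≡ 0 → v ≡ 0 → e * w ≡ 0 → c * u ≡ d * v + e * w
    vanishing c d e refl refl ew≡0 = trans (*-zeroʳ c) (sym (cong₂ _+_ (*-zeroʳ d) ew≡0))

  term-recurrence : ∀ a B j → suc a * term (suc a) B j ≡ (suc a + B) * term a B j + B * shift (term a (pred B)) j
  term-recurrence a B zero = begin
    suc a * multinomial (suc a) B 0     ≡⟨ multinomial-sucˡ a B 0 ⟩
    suc (a + B + 0) * multinomial a B 0 ≡⟨ cong (λ n → suc n * multinomial a B 0) (+-identityʳ (a + B)) ⟩
    (suc a + B) * multinomial a B 0     ≡⟨ trans (cong ((suc a + B) * multinomial a B 0 +_) (*-zeroʳ B)) (+-identityʳ _) ⟨
    (suc a + B) * multinomial a B 0 + B * 0 ∎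
  term-recurrence a zero (suc j) =
    vanishing {w = term a 0 j} (suc a) (suc a + 0) 0
              (term-> {suc a} {0} {suc j} (s≤s z≤n)) (term-> {a} {0} {suc j} (s≤s (≤-trans (m⊓n≤n a 0) z≤n))) refl
  term-recurrence a (suc b) (suc i) with ≤-<-connex i (a ⊓ b)
  ... | inj₂ a⊓b<i =
    vanishing (suc a) (suc a + suc b) (suc b) (term-> {suc a} (s≤s a⊓b<i)) (term-> a⊓sb<si)
              (trans (cong (suc b *_) (term-> a⊓b<i)) (*-zeroʳ (suc b)))
    where
    a⊓sb<si : a ⊓ suc b < suc i
    a⊓sb<si = s≤s (≤-trans (⊓-monoˡ-≤ (suc b) (n≤1+n a)) a⊓b<i)
  ... | inj₁ i≤a⊓b with m≤n⇒∃[o]m+o≡n (≤-trans i≤a⊓b (m⊓n≤m a b))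
                     | m≤n⇒∃[o]m+o≡n (≤-trans i≤a⊓b (m⊓n≤n a b))
  ...   | x , refl | y , refl = begin
    suc (i + x) * term (suc i + x) (suc i + y) (suc i)
      ≡⟨ cong (suc (i + x) *_) (term-+ (suc i) x y) ⟩
    suc (i + x) * multinomial x y (suc i)
      ≡⟨ weighted-pascal i x y (term-below i x y) (sym (multinomial-sucʳ x y i)) ⟩
    (suc (i + x) + suc (i + y)) * term (i + x) (suc (i + y)) (suc i) + suc (i + y) * multinomial x y i
      ≡⟨ cong (λ u → (suc (i + x) + suc (i + y)) * term (i + x) (suc (i + y)) (suc i) + suc (i + y) * u) (term-+ i x y) ⟨
    (suc (i + x) + suc (i + y)) * term (i + x) (suc (i + y)) (suc i) + suc (i + y) * term (i + x) (i + y) i ∎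

  delannoy-recurrence : ∀ a B → suc a * delannoy (suc a) B ≡ (suc a + B) * delannoy a B + B * delannoy a (pred B)
  delannoy-recurrence a B = begin
    suc a * delannoy (suc a) B
      ≡⟨ cong (suc a *_) (delannoy-sumTo (s≤s (m⊓n≤m (suc a) B))) ⟨
    suc a * sumTo K (term (suc a) B)
      ≡⟨ *-distribˡ-sumTo K (suc a) (term (suc a) B) ⟩
    sumTo K (λ j → suc a * term (suc a) B j)
      ≡⟨ sumTo-cong K (term-recurrence a B) ⟩
    sumTo K (λ j → (suc a + B) * term a B j + B * shift (term a (pred B)) j)
      ≡⟨ sumTo-distrib-+ K _ _ ⟩
    sumTo K (λ j → (suc a + B) * term a B j) + sumTo K (λ j → B * shift (term a (pred B)) j)
      ≡⟨ cong₂ _+_ (*-distribˡ-sumTo K (suc a + B) (term a B)) (*-distribˡ-sumTo K B (shift (term a (pred B)))) ⟨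
    (suc a + B) * sumTo K (term a B) + B * sumTo K (shift (term a (pred B)))
      ≡⟨ cong₂ (λ u v → (suc a + B) * u + B * v)
               (delannoy-sumTo (s≤s (m≤n⇒m≤1+n (m⊓n≤m a B))))
               (trans (sumTo-shift (suc a) (term a (pred B))) (delannoy-sumTo (s≤s (m⊓n≤m a (pred B))))) ⟩
    (suc a + B) * delannoy a B + B * delannoy a (pred B) ∎
    where K = suc (suc a)

  delannoy-diagonal : ∀ k → delannoy (suc k) (suc k) ≡ 2 * delannoy k (suc k) + delannoy k k
  delannoy-diagonal k = *-cancelˡ-≡ _ _ (suc k) (begin
    suc k * delannoy (suc k) (suc k)                                   ≡⟨ delannoy-recurrence k (suc k) ⟩
    (suc k + suc k) * delannoy k (suc k) + suc k * delannoy k k        ≡⟨ factor k (delannoy k (suc k)) (delannoy k k) ⟩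
    suc k * (2 * delannoy k (suc k) + delannoy k k)                    ∎)
    where
    factor : ∀ k a b → (suc k + suc k) * a + suc k * b ≡ suc k * (2 * a + b)
    factor = solve-∀

  delannoy-near-diagonal : ∀ m → suc m * delannoy m (suc m) ≡ (suc m + m) * delannoy m m + m * delannoy (pred m) m
  delannoy-near-diagonal m = begin
    suc m * delannoy m (suc m)                              ≡⟨ cong (suc m *_) (delannoy-comm m (suc m)) ⟩
    suc m * delannoy (suc m) m                              ≡⟨ delannoy-recurrence m m ⟩
    (suc m + m) * delannoy m m + m * delannoy m (pred m)
      ≡⟨ cong (λ u → (suc m + m) * delannoy m m + m * u) (delannoy-comm m (pred m)) ⟩
    (suc m + m) * delannoy m m + m * delannoy (pred m) m    ∎


module PellDefect where

  open import Data.Integer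
  open import Data.Integer.Tactic.RingSolver using (solve-∀)
  open import Relation.Binary.PropositionalEquality
  open ≡-Reasoning

  -- the norm of (u + v) + v√2
  defect : ℤ → ℤ → ℤ
  defect u v = (u + v) * (u + v) - + 2 * (v * v)

  -- multiplication of (u + v) + v√2 by the unit 1 + √2, of norm -1
  defect-unit : ∀ u v → defect v (+ 2 * v + u) ≡ - defect u v
  defect-unit = polynomial
    where
    polynomial : ∀ u v → (v + (+ 2 * v + u)) * (v + (+ 2 * v + u)) - + 2 * ((+ 2 * v + u) * (+ 2 * v + u)) ≡
                         - ((u + v) * (u + v) - + 2 * (v * v))
    polynomial = solve-∀

  defect-recurrence : ∀ m y z w → (1ℤ + m) * w ≡ (1ℤ + m + m) * z + m * y →
    + 4 * ((1ℤ + m) * ((1ℤ + m) * defect z w)) ≡ (+ 16 * m + + 8) * (z * z) - m * (+ 4 * m * defect y z)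
  defect-recurrence m y z w rec = begin
    + 4 * ((1ℤ + m) * ((1ℤ + m) * defect z w))                ≡⟨ homogeneous m z w ⟩
    + 4 * defect ((1ℤ + m) * z) ((1ℤ + m) * w)                ≡⟨ cong (λ u → + 4 * defect ((1ℤ + m) * z) u) rec ⟩
    + 4 * defect ((1ℤ + m) * z) ((1ℤ + m + m) * z + m * y)    ≡⟨ expand m y z ⟩
    (+ 16 * m + + 8) * (z * z) - m * (+ 4 * m * defect y z)   ∎
    where
    homogeneous : ∀ m z w →
      + 4 * ((1ℤ + m) * ((1ℤ + m) * ((z + w) * (z + w) - + 2 * (w * w)))) ≡
      + 4 * (((1ℤ + m) * z + (1ℤ + m) * w) * ((1ℤ + m) * z + (1ℤ + m) * w) - + 2 * (((1ℤ + m) * w) * ((1ℤ + m) * w)))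
    homogeneous = solve-∀
    expand : ∀ m y z →
      + 4 * (((1ℤ + m) * z + ((1ℤ + m + m) * z + m * y)) * ((1ℤ + m) * z + ((1ℤ + m + m) * z + m * y))
             - + 2 * (((1ℤ + m + m) * z + m * y) * ((1ℤ + m + m) * z + m * y))) ≡
      (+ 16 * m + + 8) * (z * z) - m * (+ 4 * m * ((y + z) * (y + z) - + 2 * (z * z)))
    expand = solve-∀


module Approximation where

  open import Data.Nat
  open import Data.Nat.Properties
  open import Data.Nat.Tactic.RingSolver using (solve-∀)
  open import Data.Integer as ℤ using (+_; ∣_∣)
  import Data.Integer.Properties as ℤ
  open import Data.Product using (_×_; _,_)
  open import Data.Sum using (inj₁; inj₂)
  open import Relation.Binary.PropositionalEquality
  open PellDefect

  -- |(y/z + 1)² - 2| ≤ 10/c; the constant 10 is one that both steps of the recurrence preserve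
  Approx : ℕ → ℕ → ℕ → Set
  Approx c y z = c * ∣ defect (+ y) (+ z) ∣ ≤ 10 * (z * z)

  approx-even : ∀ c y z → Approx c y z → Approx (4 * c) z (2 * z + y)
  approx-even c y z close = begin
    4 * c * ∣ defect (+ z) (+ (2 * z + y)) ∣          ≡⟨ cong (λ u → 4 * c * ∣ defect (+ z) u ∣) cast ⟩
    4 * c * ∣ defect (+ z) (+ 2 ℤ.* + z ℤ.+ + y) ∣    ≡⟨ cong (λ u → 4 * c * ∣ u ∣) (defect-unit (+ y) (+ z)) ⟩
    4 * c * ∣ ℤ.- defect (+ y) (+ z) ∣                ≡⟨ cong (4 * c *_) (ℤ.∣-i∣≡∣i∣ (defect (+ y) (+ z))) ⟩
    4 * c * ∣ defect (+ y) (+ z) ∣                    ≡⟨ *-assoc 4 c _ ⟩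
    4 * (c * ∣ defect (+ y) (+ z) ∣)                  ≤⟨ *-monoʳ-≤ 4 close ⟩
    4 * (10 * (z * z))                                ≡⟨ regroup z ⟩
    10 * (2 * z * (2 * z))                            ≤⟨ *-monoʳ-≤ 10 (*-mono-≤ (m≤m+n (2 * z) y) (m≤m+n (2 * z) y)) ⟩
    10 * ((2 * z + y) * (2 * z + y))                  ∎
    where
    open ≤-Reasoning
    cast : + (2 * z + y) ≡ + 2 ℤ.* + z ℤ.+ + y
    cast = trans (ℤ.pos-+ (2 * z) y) (cong (ℤ._+ + y) (ℤ.pos-* 2 z))
    regroup : ∀ z → 4 * (10 * (z * z)) ≡ 10 * (2 * z * (2 * z))
    regroup = solve-∀

  ∣defect∣-recurrence : ∀ m y z w → suc m * w ≡ (suc m + m) * z + m * y →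
    4 * suc m * (suc m * ∣ defect (+ z) (+ w) ∣) ≤ (16 * m + 8) * (z * z) + m * (4 * m * ∣ defect (+ y) (+ z) ∣)
  ∣defect∣-recurrence m y z w rec = begin
    4 * suc m * (suc m * ∣ d′ ∣)                                 ≡⟨ *-assoc 4 (suc m) (suc m * ∣ d′ ∣) ⟩
    4 * (suc m * (suc m * ∣ d′ ∣))                               ≡⟨ absolute-values ⟨
    ∣ + 4 ℤ.* (+ suc m ℤ.* (+ suc m ℤ.* d′)) ∣                  ≡⟨ cong ∣_∣ (defect-recurrence (+ m) (+ y) (+ z) (+ w) cast) ⟩
    ∣ u ℤ.- + m ℤ.* (+ 4 ℤ.* + m ℤ.* d) ∣                      ≤⟨ ℤ.∣i-j∣≤∣i∣+∣j∣ u (+ m ℤ.* (+ 4 ℤ.* + m ℤ.* d)) ⟩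
    ∣ u ∣ + ∣ + m ℤ.* (+ 4 ℤ.* + m ℤ.* d) ∣                    ≡⟨ cong₂ _+_ first second ⟩
    (16 * m + 8) * (z * z) + m * (4 * m * ∣ d ∣)                ∎
    where
    open ≤-Reasoning
    d = defect (+ y) (+ z)
    d′ = defect (+ z) (+ w)
    u = (+ 16 ℤ.* + m ℤ.+ + 8) ℤ.* (+ z ℤ.* + z)
    cast : + suc m ℤ.* + w ≡ + (suc m + m) ℤ.* + z ℤ.+ + m ℤ.* + y
    cast = trans (sym (ℤ.pos-* (suc m) w))
                 (trans (cong +_ rec) (cong₂ ℤ._+_ (ℤ.pos-* (suc m + m) z) (ℤ.pos-* m y)))
    absolute-values : ∣ + 4 ℤ.* (+ suc m ℤ.* (+ suc m ℤ.* d′)) ∣ ≡ 4 * (suc m * (suc m * ∣ d′ ∣))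
    absolute-values = trans (ℤ.abs-* (+ 4) (+ suc m ℤ.* (+ suc m ℤ.* d′)))
      (cong (4 *_) (trans (ℤ.abs-* (+ suc m) (+ suc m ℤ.* d′)) (cong (suc m *_) (ℤ.abs-* (+ suc m) d′))))
    first : ∣ u ∣ ≡ (16 * m + 8) * (z * z)
    first = trans (ℤ.abs-* (+ 16 ℤ.* + m ℤ.+ + 8) (+ z ℤ.* + z))
                  (cong₂ _*_ (cong (λ i → ∣ i ℤ.+ + 8 ∣) (sym (ℤ.pos-* 16 m))) (ℤ.abs-* (+ z) (+ z)))
    second : ∣ + m ℤ.* (+ 4 ℤ.* + m ℤ.* d) ∣ ≡ m * (4 * m * ∣ d ∣)
    second = trans (ℤ.abs-* (+ m) (+ 4 ℤ.* + m ℤ.* d))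
      (cong (m *_) (trans (ℤ.abs-* (+ 4 ℤ.* + m) d) (cong (_* ∣ d ∣) (ℤ.abs-* (+ 4) (+ m)))))

  approx-odd : ∀ m y z w → suc m * w ≡ (suc m + m) * z + m * y → Approx (4 * m) y z → Approx (suc m) z w
  approx-odd m y z w rec close = *-cancelˡ-≤ (4 * suc m) (begin
    4 * suc m * (suc m * ∣ defect (+ z) (+ w) ∣)                  ≤⟨ ∣defect∣-recurrence m y z w rec ⟩
    (16 * m + 8) * (z * z) + m * (4 * m * ∣ defect (+ y) (+ z) ∣)
                                      ≤⟨ +-monoʳ-≤ ((16 * m + 8) * (z * z)) (*-monoʳ-≤ m close) ⟩
    (16 * m + 8) * (z * z) + m * (10 * (z * z))                   ≡⟨ collect m (z * z) ⟩
    (26 * m + 8) * (z * z)            ≤⟨ *-mono-≤ (m≤m+n (26 * m + 8) (14 * m + 32)) (*-mono-≤ z≤w z≤w) ⟩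
    (26 * m + 8 + (14 * m + 32)) * (w * w)                        ≡⟨ collect′ m (w * w) ⟩
    4 * suc m * (10 * (w * w))                                    ∎)
    where
    open ≤-Reasoning
    z≤w : z ≤ w
    z≤w = *-cancelˡ-≤ (suc m) (begin
      suc m * z                 ≤⟨ *-monoˡ-≤ z (m≤m+n (suc m) m) ⟩
      (suc m + m) * z           ≤⟨ m≤m+n ((suc m + m) * z) (m * y) ⟩
      (suc m + m) * z + m * y   ≡⟨ rec ⟨
      suc m * w                 ∎)
    collect : ∀ m s → (16 * m + 8) * s + m * (10 * s) ≡ (26 * m + 8) * s
    collect = solve-∀
    collect′ : ∀ m s → (26 * m + 8 + (14 * m + 32)) * s ≡ 4 * suc m * (10 * s)
    collect′ = solve-∀

  *∣⊖∣≤⇒≤ : ∀ c a b {t} → c * ∣ a ℤ.⊖ b ∣ ≤ t → c * a ≤ c * b + t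
  *∣⊖∣≤⇒≤ c a b {t} bound with ≤-total a b
  ... | inj₁ a≤b = ≤-trans (*-monoʳ-≤ c a≤b) (m≤m+n (c * b) t)
  ... | inj₂ b≤a = begin
    c * a                 ≡⟨ cong (c *_) (m+[n∸m]≡n b≤a) ⟨
    c * (b + (a ∸ b))     ≡⟨ *-distribˡ-+ c b (a ∸ b) ⟩
    c * b + c * (a ∸ b)
      ≡⟨ cong (λ n → c * b + c * n) (trans (ℤ.∣m⊖n∣≡∣n⊖m∣ a b) (ℤ.∣⊖∣-≤ b≤a)) ⟨
    c * b + c * ∣ a ℤ.⊖ b ∣ ≤⟨ +-monoʳ-≤ (c * b) bound ⟩
    c * b + t             ∎
    where open ≤-Reasoning

  defect-⊖ : ∀ y z → defect (+ y) (+ z) ≡ ((y + z) * (y + z)) ℤ.⊖ (2 * (z * z))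
  defect-⊖ y z = trans (cong₂ ℤ._-_ (sym (ℤ.pos-* (y + z) (y + z)))
                                    (trans (cong (+ 2 ℤ.*_) (sym (ℤ.pos-* z z))) (sym (ℤ.pos-* 2 (z * z)))))
                       (ℤ.m-n≡m⊖n ((y + z) * (y + z)) (2 * (z * z)))

  approx-bounds : ∀ c y z → Approx c y z →
    (c * ((y + z) * (y + z)) ≤ c * (2 * (z * z)) + 10 * (z * z)) ×
    (c * (2 * (z * z)) ≤ c * ((y + z) * (y + z)) + 10 * (z * z))
  approx-bounds c y z close =
    *∣⊖∣≤⇒≤ c S T close′ ,
    *∣⊖∣≤⇒≤ c T S (subst (λ n → c * n ≤ 10 * (z * z)) (ℤ.∣m⊖n∣≡∣n⊖m∣ S T) close′)
    where
    S = (y + z) * (y + z)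
    T = 2 * (z * z)
    close′ : c * ∣ ((y + z) * (y + z)) ℤ.⊖ (2 * (z * z)) ∣ ≤ 10 * (z * z)
    close′ = subst (λ i → c * ∣ i ∣ ≤ 10 * (z * z)) (defect-⊖ y z) close


module Rationals where

  open import Data.Nat as ℕ using (ℕ; suc; z≤n)
  import Data.Nat.Properties as ℕ
  import Data.Nat.Coprimality as Coprimality
  open import Data.Integer as ℤ using (+_; -[1+_])
  import Data.Integer.Properties as ℤ
  open import Data.Rational
  open import Data.Rational.Properties
  import Data.Rational.Unnormalised as ℚᵘ
  open import Data.Product using (Σ; _,_; proj₁; proj₂)
  open import Relation.Binary.PropositionalEquality
  open import Relation.Nullary using (yes; no; contradiction)

  fromℕ : ℕ → ℚ
  fromℕ n = + n / 1

  fromℕ≡mkℚ : ∀ n → fromℕ n ≡ mkℚ (+ n) 0 (Coprimality.sym (Coprimality.1-coprimeTo n))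
  fromℕ≡mkℚ n = normalize-coprime (Coprimality.sym (Coprimality.1-coprimeTo n))

  fromℕ-+ : ∀ m n → fromℕ (m ℕ.+ n) ≡ fromℕ m + fromℕ n
  fromℕ-+ m n = sym (trans (cong₂ _+_ (fromℕ≡mkℚ m) (fromℕ≡mkℚ n))
                           (cong (_/ 1) (cong₂ ℤ._+_ (ℤ.*-identityʳ (+ m)) (ℤ.*-identityʳ (+ n)))))

  fromℕ-* : ∀ m n → fromℕ (m ℕ.* n) ≡ fromℕ m * fromℕ n
  fromℕ-* m n = sym (trans (cong₂ _*_ (fromℕ≡mkℚ m) (fromℕ≡mkℚ n)) (cong (_/ 1) (ℤ.+◃n≡+n (m ℕ.* n))))

  fromℕ-mono-≤ : ∀ {m n} → m ℕ.≤ n → fromℕ m ≤ fromℕ n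
  fromℕ-mono-≤ {m} {n} m≤n = subst₂ _≤_ (sym (fromℕ≡mkℚ m)) (sym (fromℕ≡mkℚ n))
    (*≤* (subst₂ ℤ._≤_ (sym (ℤ.*-identityʳ (+ m))) (sym (ℤ.*-identityʳ (+ n))) (ℤ.+≤+ m≤n)))

  fromℕ-mono-< : ∀ {m n} → m ℕ.< n → fromℕ m < fromℕ n
  fromℕ-mono-< {m} {n} m<n = subst₂ _<_ (sym (fromℕ≡mkℚ m)) (sym (fromℕ≡mkℚ n))
    (*<* (subst₂ ℤ._<_ (sym (ℤ.*-identityʳ (+ m))) (sym (ℤ.*-identityʳ (+ n))) (ℤ.+<+ m<n)))

  fromℕ-nonNeg : ∀ n → NonNegative (fromℕ n)
  fromℕ-nonNeg n = nonNegative (fromℕ-mono-≤ {0} {n} z≤n)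

  /-exact : ∀ m d .{{_ : ℕ.NonZero d}} c → m ≡ c ℕ.* d → + m / d ≡ fromℕ c
  /-exact m (suc d) c m≡cd = fromℚᵘ-cong {ℚᵘ.mkℚᵘ (+ m) d} {ℚᵘ.mkℚᵘ (+ c) 0} (ℚᵘ.*≡* (begin
    + m ℤ.* + 1             ≡⟨ ℤ.*-identityʳ (+ m) ⟩
    + m                     ≡⟨ cong +_ m≡cd ⟩
    + (c ℕ.* suc d)         ≡⟨ ℤ.+◃n≡+n (c ℕ.* suc d) ⟨
    + c ℤ.* + suc d         ∎))
    where open ≡-Reasoning

  ÷′-inverse : ∀ p {q} → 0ℚ < q → (p ÷' q) * q ≡ p
  ÷′-inverse p {q} 0<q with q ≟ 0ℚ
  ... | yes q≡0 = contradiction (sym q≡0) (<⇒≢ 0<q)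
  ... | no  q≢0 = begin
    p * 1/ q * q    ≡⟨ *-assoc p (1/ q) q ⟩
    p * (1/ q * q)  ≡⟨ cong (p *_) (*-inverseˡ q) ⟩
    p * 1ℚ          ≡⟨ *-identityʳ p ⟩
    p               ∎
    where
    open ≡-Reasoning
    instance _ = ≢-nonZero q≢0

  ÷′-nonNeg : ∀ {p q} → 0ℚ ≤ p → 0ℚ < q → 0ℚ ≤ p ÷' q
  ÷′-nonNeg {p} {q} 0≤p 0<q with q ≟ 0ℚ
  ... | yes _   = ≤-refl
  ... | no  q≢0 = nonNegative⁻¹ _ {{nonNeg*nonNeg⇒nonNeg p (1/ q)}}
    where
    instance
      q-nonZero : NonZero q
      q-nonZero = ≢-nonZero q≢0
      q-pos : Positive q
      q-pos = positive 0<q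
      p-nonNeg : NonNegative p
      p-nonNeg = nonNegative 0≤p
      1/q-pos : Positive (1/ q)
      1/q-pos = 1/pos⇒pos q
      1/q-nonNeg : NonNegative (1/ q)
      1/q-nonNeg = pos⇒nonNeg (1/ q)

  ≤-fromℕ : ∀ p → Σ ℕ λ n → p ≤ fromℕ n
  ≤-fromℕ p@(mkℚ i d _) = ℤ.∣ i ∣ , subst (p ≤_) (sym (fromℕ≡mkℚ ℤ.∣ i ∣)) (*≤* (begin
    i ℤ.* + 1                    ≡⟨ ℤ.*-identityʳ i ⟩
    i                            ≤⟨ i≤+∣i∣ i ⟩
    + ℤ.∣ i ∣                    ≤⟨ ℤ.+≤+ (ℕ.m≤m*n ℤ.∣ i ∣ (suc d)) ⟩
    + (ℤ.∣ i ∣ ℕ.* suc d)        ≡⟨ ℤ.+◃n≡+n (ℤ.∣ i ∣ ℕ.* suc d) ⟨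
    + ℤ.∣ i ∣ ℤ.* + suc d        ∎))
    where
    open ℤ.≤-Reasoning
    i≤+∣i∣ : ∀ i → i ℤ.≤ + ℤ.∣ i ∣
    i≤+∣i∣ (+ n)    = ℤ.≤-refl
    i≤+∣i∣ -[1+ n ] = ℤ.-≤+

  archimedean : ∀ ε {δ} → 0ℚ < δ → Σ ℕ λ c₀ → ∀ c → c₀ ℕ.≤ c → ε < fromℕ c * δ
  archimedean ε {δ} 0<δ = suc n , λ c n<c → begin-strict
    ε                     ≡⟨ ÷′-inverse ε 0<δ ⟨
    (ε ÷' δ) * δ          ≤⟨ *-monoʳ-≤-nonNeg δ ε/δ≤n ⟩
    fromℕ n * δ           <⟨ *-monoˡ-<-pos δ (fromℕ-mono-< n<c) ⟩
    fromℕ c * δ           ∎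
    where
    open ≤-Reasoning
    instance _ = positive 0<δ
    instance _ = pos⇒nonNeg δ
    n = proj₁ (≤-fromℕ (ε ÷' δ))
    ε/δ≤n = proj₂ (≤-fromℕ (ε ÷' δ))

  *-cancelʳ-≤-+ : ∀ {p q r} s → 0ℚ < s → p * s ≤ q * s + r * s → p ≤ q + r
  *-cancelʳ-≤-+ {p} {q} {r} s 0<s ps≤qs+rs =
    *-cancelʳ-≤-pos s {{positive 0<s}} (subst (p * s ≤_) (sym (*-distribʳ-+ s q r)) ps≤qs+rs)

  fromℕ-mono-≤-+ : ∀ {m n k} → m ℕ.≤ n ℕ.+ k → fromℕ m ≤ fromℕ n + fromℕ k
  fromℕ-mono-≤-+ {m} {n} {k} m≤n+k = subst (fromℕ m ≤_) (fromℕ-+ n k) (fromℕ-mono-≤ m≤n+k)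

  square-mono-≤ : ∀ {p q} → 0ℚ ≤ p → p ≤ q → p * p ≤ q * q
  square-mono-≤ {p} {q} 0≤p p≤q = ≤-trans (*-monoʳ-≤-nonNeg p {{nonNegative 0≤p}} p≤q)
                                          (*-monoˡ-≤-nonNeg q {{nonNegative (≤-trans 0≤p p≤q)}} p≤q)

  0<q-p : ∀ {p q} → p < q → 0ℚ < q - p
  0<q-p {p} {q} p<q = ≤-<-trans (≤-reflexive (sym (+-inverseʳ p))) (+-monoˡ-< (- p) p<q)


module Sqrt2Cut where

  open import Data.Nat as ℕ using (ℕ; z≤n; s≤s)
  import Data.Nat.Properties as ℕ
  import Data.Integer as ℤ
  open import Data.Rational
  open import Data.Rational.Properties
  open import Data.Rational.Solver using (module +-*-Solver)
  open import Data.Product using (Σ; _×_; _,_; proj₁; proj₂)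
  open import Data.Sum using (inj₁; inj₂)
  open import Relation.Binary.PropositionalEquality
  open +-*-Solver
  open Approximation using (Approx; approx-bounds)
  open Rationals

  two : ℚ
  two = 1ℚ + 1ℚ

  eventually-above : ∀ a → BelowSqrt2Minus1 a → ∀ ε → Σ ℕ λ c₀ → ∀ c x → c₀ ℕ.≤ c → 0ℚ ≤ x →
                     fromℕ c * two ≤ fromℕ c * ((x + 1ℚ) * (x + 1ℚ)) + ε → a < x
  eventually-above a (inj₁ a+1<0) ε = 0 , λ c x _ 0≤x _ → ≰⇒> λ x≤a → <-irrefl refl (begin-strict
    0ℚ              <⟨ *<* (ℤ.+<+ (s≤s z≤n)) ⟩
    1ℚ              ≡⟨ +-identityˡ 1ℚ ⟨
    0ℚ + 1ℚ         ≤⟨ +-monoˡ-≤ 1ℚ (≤-trans 0≤x x≤a) ⟩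
    a + 1ℚ          <⟨ a+1<0 ⟩
    0ℚ              ∎)
    where open ≤-Reasoning
  eventually-above a (inj₂ α²<2) ε = c₀ , λ c x c₀≤c 0≤x bound → ≰⇒> λ x≤a → <-irrefl refl (begin-strict
    fromℕ c * two                                 ≤⟨ bound ⟩
    fromℕ c * ((x + 1ℚ) * (x + 1ℚ)) + ε           ≤⟨ +-monoˡ-≤ ε (*-monoˡ-≤-nonNeg (fromℕ c) {{fromℕ-nonNeg c}}
                                                       (square-mono-≤ (≤-trans 0≤x (p≤p+1 x)) (+-monoˡ-≤ 1ℚ x≤a))) ⟩
    fromℕ c * (α * α) + ε                         <⟨ +-monoʳ-< (fromℕ c * (α * α)) (large c c₀≤c) ⟩
    fromℕ c * (α * α) + fromℕ c * (two - α * α)   ≡⟨ complete (fromℕ c) (α * α) ⟩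
    fromℕ c * two                                 ∎)
    where
    open ≤-Reasoning
    α = a + 1ℚ
    c₀ = proj₁ (archimedean ε (0<q-p α²<2))
    large = proj₂ (archimedean ε (0<q-p α²<2))
    p≤p+1 : ∀ p → p ≤ p + 1ℚ
    p≤p+1 p = ≤-trans (≤-reflexive (sym (+-identityʳ p))) (+-monoʳ-≤ p (*≤* (ℤ.+≤+ z≤n)))
    complete : ∀ c s → c * s + c * (two - s) ≡ c * two
    complete = solve 2 (λ c s → c :* s :+ c :* ((con 1ℚ :+ con 1ℚ) :- s) := c :* (con 1ℚ :+ con 1ℚ)) refl

  eventually-below : ∀ b → AboveSqrt2Minus1 b → ∀ ε → Σ ℕ λ c₀ → ∀ c x → c₀ ℕ.≤ c →
                     fromℕ c * ((x + 1ℚ) * (x + 1ℚ)) ≤ fromℕ c * two + ε → x < b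
  eventually-below b (0<β , 2<β²) ε = c₀ , λ c x c₀≤c bound → ≰⇒> λ b≤x → <-irrefl refl (begin-strict
    fromℕ c * two + ε                             <⟨ +-monoʳ-< (fromℕ c * two) (large c c₀≤c) ⟩
    fromℕ c * two + fromℕ c * (β * β - two)       ≡⟨ complete (fromℕ c) (β * β) ⟩
    fromℕ c * (β * β)                             ≤⟨ *-monoˡ-≤-nonNeg (fromℕ c) {{fromℕ-nonNeg c}}
                                                       (square-mono-≤ (<⇒≤ 0<β) (+-monoˡ-≤ 1ℚ b≤x)) ⟩
    fromℕ c * ((x + 1ℚ) * (x + 1ℚ))               ≤⟨ bound ⟩
    fromℕ c * two + ε                             ∎)
    where
    open ≤-Reasoning
    β = b + 1ℚ
    c₀ = proj₁ (archimedean ε (0<q-p 2<β²))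
    large = proj₂ (archimedean ε (0<q-p 2<β²))
    complete : ∀ c s → c * two + c * (s - two) ≡ c * s
    complete = solve 2 (λ c s → c :* (con 1ℚ :+ con 1ℚ) :+ c :* (s :- (con 1ℚ :+ con 1ℚ)) := c :* s) refl

  approx⇒square-bounds : ∀ c y z → 0 ℕ.< z → Approx c y z →
    let X = (fromℕ y ÷' fromℕ z) + 1ℚ in
    (fromℕ c * (X * X) ≤ fromℕ c * two + fromℕ 10) × (fromℕ c * two ≤ fromℕ c * (X * X) + fromℕ 10)
  approx⇒square-bounds c y z 0<z close =
    divide-by-Z² S T {fromℕ c * (X * X)} {fromℕ c * two} (proj₁ bounds) cS cT ,
    divide-by-Z² T S {fromℕ c * two} {fromℕ c * (X * X)} (proj₂ bounds) cT cS
    where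
    open ≡-Reasoning
    bounds = approx-bounds c y z close
    S = c ℕ.* ((y ℕ.+ z) ℕ.* (y ℕ.+ z))
    T = c ℕ.* (2 ℕ.* (z ℕ.* z))
    Z = fromℕ z
    x = fromℕ y ÷' Z
    X = x + 1ℚ
    0<Z² : 0ℚ < Z * Z
    0<Z² = subst (0ℚ <_) (fromℕ-* z z) (fromℕ-mono-< (ℕ.*-mono-≤ 0<z 0<z))
    divide-by-Z² : ∀ m n {P Q} → m ℕ.≤ n ℕ.+ 10 ℕ.* (z ℕ.* z) →
                   fromℕ m ≡ P * (Z * Z) → fromℕ n ≡ Q * (Z * Z) → P ≤ Q + fromℕ 10
    divide-by-Z² m n {P} {Q} m≤n+10z² eP eQ = *-cancelʳ-≤-+ {P} {Q} {fromℕ 10} (Z * Z) 0<Z²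
      (subst₂ (λ u v → u ≤ v + fromℕ 10 * (Z * Z)) eP eQ
        (subst (λ u → fromℕ m ≤ fromℕ n + u) (trans (fromℕ-* 10 (z ℕ.* z)) (cong (fromℕ 10 *_) (fromℕ-* z z)))
          (fromℕ-mono-≤-+ {m} {n} m≤n+10z²)))
    fromℕ-y+z : fromℕ (y ℕ.+ z) ≡ X * Z
    fromℕ-y+z = begin
      fromℕ (y ℕ.+ z)    ≡⟨ fromℕ-+ y z ⟩
      fromℕ y + Z        ≡⟨ cong (_+ Z) (÷′-inverse (fromℕ y) (fromℕ-mono-< 0<z)) ⟨
      x * Z + Z          ≡⟨ solve 2 (λ x Z → x :* Z :+ Z := (x :+ con 1ℚ) :* Z) refl x Z ⟩
      X * Z              ∎
    cS : fromℕ S ≡ fromℕ c * (X * X) * (Z * Z)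
    cS = begin
      fromℕ (c ℕ.* ((y ℕ.+ z) ℕ.* (y ℕ.+ z)))
        ≡⟨ trans (fromℕ-* c _) (cong (fromℕ c *_) (fromℕ-* (y ℕ.+ z) (y ℕ.+ z))) ⟩
      fromℕ c * (fromℕ (y ℕ.+ z) * fromℕ (y ℕ.+ z))
        ≡⟨ cong (λ u → fromℕ c * (u * u)) fromℕ-y+z ⟩
      fromℕ c * ((X * Z) * (X * Z))
        ≡⟨ solve 3 (λ c X Z → c :* ((X :* Z) :* (X :* Z)) := c :* (X :* X) :* (Z :* Z)) refl (fromℕ c) X Z ⟩
      fromℕ c * (X * X) * (Z * Z) ∎
    cT : fromℕ T ≡ fromℕ c * two * (Z * Z)
    cT = begin
      fromℕ (c ℕ.* (2 ℕ.* (z ℕ.* z)))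
        ≡⟨ trans (fromℕ-* c _) (cong (fromℕ c *_) (trans (fromℕ-* 2 (z ℕ.* z)) (cong₂ _*_ (fromℕ-+ 1 1) (fromℕ-* z z)))) ⟩
      fromℕ c * (two * (Z * Z))
        ≡⟨ *-assoc (fromℕ c) two (Z * Z) ⟨
      fromℕ c * two * (Z * Z) ∎

  record Approximant (c : ℕ) (x : ℚ) : Set where
    field
      numerator denominator : ℕ
      denominator-pos : 0 ℕ.< denominator
      approx : Approx c numerator denominator
      x≡ratio : x ≡ fromℕ numerator ÷' fromℕ denominator

  approximant-between : ∀ a b → BelowSqrt2Minus1 a → AboveSqrt2Minus1 b →
                        Σ ℕ λ c₀ → ∀ {c x} → c₀ ℕ.≤ c → Approximant c x → (a < x) × (x < b)
  approximant-between a b a<√2-1 √2-1<b = cₐ ℕ.+ c_b , λ {c} c₀≤c A →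
    let open Approximant A
        bounds = approx⇒square-bounds c numerator denominator denominator-pos approx
        0≤x = ÷′-nonNeg (fromℕ-mono-≤ {0} {numerator} z≤n) (fromℕ-mono-< denominator-pos)
    in subst (λ x → (a < x) × (x < b)) (sym x≡ratio)
         (proj₂ above c _ (ℕ.≤-trans (ℕ.m≤m+n cₐ c_b) c₀≤c) 0≤x (proj₂ bounds) ,
          proj₂ below c _ (ℕ.≤-trans (ℕ.m≤n+m c_b cₐ) c₀≤c) (proj₁ bounds))
    where
    above = eventually-above a a<√2-1 (fromℕ 10)
    below = eventually-below b √2-1<b (fromℕ 10)
    cₐ = proj₁ above
    c_b = proj₁ below


module SpeyerAtOne where

  open import Data.Nat
  open import Data.Nat.Properties
  open import Data.Nat.DivMod using (m*n/n≡m; +-distrib-/-∣ʳ; /-congˡ)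
  open import Data.Nat.Divisibility using (n∣m*n)
  open import Data.Nat.Tactic.RingSolver using (solve-∀)
  open import Data.Product using (_,_)
  import Data.Rational as ℚ
  import Data.Rational.Properties as ℚ
  open import Relation.Binary.PropositionalEquality
  open ≡-Reasoning
  open Multinomial
  open FiniteSums
  open Delannoy
  open Rationals using (fromℕ; fromℕ-+; /-exact)

  coeff-multinomial : ∀ j x y → coeff (suc j + x + (suc j + y)) (suc j + x) (suc j) ≡ fromℕ (multinomial x y j)
  coeff-multinomial j x y =
    /-exact _ _ {{m*n≢0 _ _ {{m*n≢0 _ _ {{(d ∸ suc j) !≢0}} {{(n ∸ d ∸ suc j) !≢0}}}} {{(suc j ∸ 1) !≢0}}}}
            (multinomial x y j) (begin
    (n ∸ suc j ∸ 1) !                                              ≡⟨ cong _! top ⟩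
    (x + y + j) !                                                  ≡⟨ multinomial-! x y j ⟨
    multinomial x y j * (x ! * y ! * j !)
      ≡⟨ cong₂ (λ u v → multinomial x y j * (u ! * v ! * j !)) left right ⟨
    multinomial x y j * ((d ∸ suc j) ! * (n ∸ d ∸ suc j) ! * (suc j ∸ 1) !) ∎)
    where
    n = suc j + x + (suc j + y)
    d = suc j + x
    left : d ∸ suc j ≡ x
    left = m+n∸m≡n (suc j) x
    right : n ∸ d ∸ suc j ≡ y
    right = trans (cong (_∸ suc j) (m+n∸m≡n d (suc j + y))) (m+n∸m≡n (suc j) y)
    regroup : ∀ x y j → x + (j + y) ≡ x + y + j
    regroup = solve-∀
    top : n ∸ suc j ∸ 1 ≡ x + y + j
    top = begin
      n ∸ suc j ∸ 1                 ≡⟨ cong (λ k → k ∸ suc j ∸ 1) (+-assoc (suc j) x (suc j + y)) ⟩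
      suc j + (x + (suc j + y)) ∸ suc j ∸ 1 ≡⟨ cong (_∸ 1) (m+n∸m≡n (suc j) (x + (suc j + y))) ⟩
      x + suc (j + y) ∸ 1           ≡⟨ cong (_∸ 1) (+-suc x (j + y)) ⟩
      x + (j + y)                   ≡⟨ regroup x y j ⟩
      x + y + j                     ∎

  coeff-term : ∀ A B j → j ≤ A ⊓ B → coeff (suc A + suc B) (suc A) (suc j) ≡ fromℕ (term A B j)
  coeff-term A B j j≤A⊓B with m≤n⇒∃[o]m+o≡n (≤-trans j≤A⊓B (m⊓n≤m A B))
                            | m≤n⇒∃[o]m+o≡n (≤-trans j≤A⊓B (m⊓n≤n A B))
  ... | x , refl | y , refl = trans (coeff-multinomial j x y) (cong fromℕ (sym (term-+ j x y)))

  sum1-fromℕ : ∀ K (G : ℕ → ℚ.ℚ) (h : ℕ → ℕ) → (∀ j → j < K → G (suc j) ≡ fromℕ (h j)) →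
               sum1 K G ≡ fromℕ (sumTo K h)
  sum1-fromℕ zero    G h G≗h = refl
  sum1-fromℕ (suc K) G h G≗h =
    trans (cong₂ ℚ._+_ (sum1-fromℕ K G h (λ j j<K → G≗h j (m≤n⇒m≤1+n j<K))) (G≗h K ≤-refl))
          (sym (fromℕ-+ (sumTo K h) (h K)))

  1ℚ^ℚ : ∀ k → ℚ.1ℚ ^ℚ k ≡ ℚ.1ℚ
  1ℚ^ℚ zero    = refl
  1ℚ^ℚ (suc k) = cong (ℚ.1ℚ ℚ.*_) (1ℚ^ℚ k)

  g-delannoy : ∀ A B → g (suc A + suc B) (suc A) ℚ.1ℚ ≡ fromℕ (delannoy A B)
  g-delannoy A B = begin
    sum1 (suc A ⊓ (suc A + suc B ∸ suc A)) G   ≡⟨ cong (λ k → sum1 (suc A ⊓ k) G) (m+n∸m≡n (suc A) (suc B)) ⟩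
    sum1 (suc (A ⊓ B)) G                       ≡⟨ sum1-fromℕ (suc (A ⊓ B)) G (term A B) G≗term ⟩
    fromℕ (delannoy A B)                       ∎
    where
    G : ℕ → ℚ.ℚ
    G i = coeff (suc A + suc B) (suc A) i ℚ.* (ℚ.1ℚ ^ℚ i)
    G≗term : ∀ j → j < suc (A ⊓ B) → G (suc j) ≡ fromℕ (term A B j)
    G≗term j (s≤s j≤A⊓B) = trans (cong (coeff (suc A + suc B) (suc A) (suc j) ℚ.*_) (1ℚ^ℚ (suc j)))
                                 (trans (ℚ.*-identityʳ (coeff (suc A + suc B) (suc A) (suc j))) (coeff-term A B j j≤A⊓B))

  half-double : ∀ n → (n + n) / 2 ≡ n
  half-double n = trans (/-congˡ {o = 2} (double n)) (m*n/n≡m n 2)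
    where
    double : ∀ n → n + n ≡ n * 2
    double = solve-∀

  half-double+1 : ∀ n → suc (n + n) / 2 ≡ n
  half-double+1 n = begin
    suc (n + n) / 2     ≡⟨ /-congˡ {o = 2} (cong suc (double n)) ⟩
    (1 + n * 2) / 2     ≡⟨ +-distrib-/-∣ʳ 1 {d = 2} (n∣m*n n) ⟩
    n * 2 / 2           ≡⟨ m*n/n≡m n 2 ⟩
    n                   ∎
    where
    double : ∀ n → n + n ≡ n * 2
    double = solve-∀

  f-delannoy : ∀ A B → (suc A + suc B) / 2 ≡ suc A → f (suc A + suc B) ℚ.1ℚ ≡ fromℕ (delannoy A B)
  f-delannoy A B half = trans (cong (λ d → g (suc A + suc B) d ℚ.1ℚ) half) (g-delannoy A B)

  f-diagonal : ∀ m → f (2 + (m + m)) ℚ.1ℚ ≡ fromℕ (delannoy m m)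
  f-diagonal m = trans (cong (λ n → f n ℚ.1ℚ) (index m)) (f-delannoy m m (half-double (suc m)))
    where
    index : ∀ m → 2 + (m + m) ≡ suc m + suc m
    index = solve-∀

  f-near-diagonal : ∀ m → f (3 + (m + m)) ℚ.1ℚ ≡ fromℕ (delannoy m (suc m))
  f-near-diagonal m = trans (cong (λ n → f n ℚ.1ℚ) (index m))
                            (f-delannoy m (suc m) (trans (/-congˡ {o = 2} (index′ m)) (half-double+1 (suc m))))
    where
    index : ∀ m → 3 + (m + m) ≡ suc m + suc (suc m)
    index = solve-∀
    index′ : ∀ m → suc m + suc (suc m) ≡ suc (suc m + suc m)
    index′ = solve-∀

  r-odd : ∀ m → r (3 + (m + m)) ℚ.1ℚ ≡ fromℕ (delannoy m m) ÷' fromℕ (delannoy m (suc m))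
  r-odd m = cong₂ _÷'_ (f-diagonal m) (f-near-diagonal m)

  r-even : ∀ m → r (3 + suc (m + m)) ℚ.1ℚ ≡ fromℕ (delannoy m (suc m)) ÷' fromℕ (delannoy (suc m) (suc m))
  r-even m = cong₂ _÷'_ (f-near-diagonal m) (trans (cong (λ n → f n ℚ.1ℚ) (index m)) (f-diagonal (suc m)))
    where
    index : ∀ m → 3 + suc (m + m) ≡ 2 + (suc m + suc m)
    index = solve-∀


module Convergence where

  open import Data.Nat
  open import Data.Nat.Properties
  open import Data.Nat.Tactic.RingSolver using (solve-∀)
  open import Data.Product using (Σ; _×_; _,_; proj₁; proj₂)
  import Data.Rational as ℚ
  open import Relation.Binary.PropositionalEquality
  open Delannoy
  open Approximation
  open Sqrt2Cut using (Approximant; approximant-between)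
  open SpeyerAtOne using (r-odd; r-even)

  mutual
    approx-D[m,m]/D[m,1+m] : ∀ m → Approx (suc m) (delannoy m m) (delannoy m (suc m))
    approx-D[m,m]/D[m,1+m] zero    = approx-1/1
      where
      approx-1/1 : Approx 1 1 1
      approx-1/1 = s≤s (s≤s z≤n)
    approx-D[m,m]/D[m,1+m] (suc k) =
      approx-odd (suc k) (delannoy k (suc k)) (delannoy (suc k) (suc k)) (delannoy (suc k) (suc (suc k)))
                 (delannoy-near-diagonal (suc k)) (approx-D[m,1+m]/D[1+m,1+m] k)

    approx-D[m,1+m]/D[1+m,1+m] : ∀ m → Approx (4 * suc m) (delannoy m (suc m)) (delannoy (suc m) (suc m))
    approx-D[m,1+m]/D[1+m,1+m] m = subst (Approx (4 * suc m) (delannoy m (suc m))) (sym (delannoy-diagonal m))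
      (approx-even (suc m) (delannoy m m) (delannoy m (suc m)) (approx-D[m,m]/D[m,1+m] m))

  data EvenOrOdd : ℕ → Set where
    even : ∀ m → EvenOrOdd (m + m)
    odd  : ∀ m → EvenOrOdd (suc (m + m))

  evenOrOdd : ∀ n → EvenOrOdd n
  evenOrOdd zero = even 0
  evenOrOdd (suc n) with evenOrOdd n
  ... | even m = odd m
  ... | odd  m = subst EvenOrOdd (cong suc (+-suc m m)) (even (suc m))

  r-approximant : ∀ k → Σ ℕ λ c → k ≤ 2 * c × Approximant c (r (3 + k) 1ℚ)
  r-approximant k with evenOrOdd k
  ... | even m = suc m , ≤-trans (m≤m+n (m + m) 2) (≤-reflexive (bound m)) , record
    { numerator = delannoy m m ; denominator = delannoy m (suc m) ; denominator-pos = delannoy-pos m (suc m)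
    ; approx = approx-D[m,m]/D[m,1+m] m ; x≡ratio = r-odd m }
    where
    bound : ∀ m → m + m + 2 ≡ 2 * suc m
    bound = solve-∀
  ... | odd m = 4 * suc m , ≤-trans (m≤m+n (suc (m + m)) (6 * m + 7)) (≤-reflexive (bound m)) , record
    { numerator = delannoy m (suc m) ; denominator = delannoy (suc m) (suc m) ; denominator-pos = delannoy-pos (suc m) (suc m)
    ; approx = approx-D[m,1+m]/D[1+m,1+m] m ; x≡ratio = r-even m }
    where
    bound : ∀ m → suc (m + m) + (6 * m + 7) ≡ 2 * (4 * suc m)
    bound = solve-∀

  approximants⇒converges : (x : ℕ → ℚ.ℚ) → (∀ k → Σ ℕ λ c → k ≤ 2 * c × Approximant c (x (3 + k))) →
                           ConvergesToSqrt2Minus1 x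
  approximants⇒converges x approximant a b a<√2-1 √2-1<b = 3 + 2 * c₀ , λ n N≤n →
    let (c , k≤2c , A) = approximant (n ∸ 3)
    in subst (λ n → (a ℚ.< x n) × (x n ℚ.< b)) (m+[n∸m]≡n (≤-trans (m≤m+n 3 (2 * c₀)) N≤n))
         (proj₂ between (*-cancelˡ-≤ 2 (≤-trans (∸-monoˡ-≤ 3 N≤n) k≤2c)) A)
    where
    between = approximant-between a b a<√2-1 √2-1<b
    c₀ = proj₁ between

open Convergence using (approximants⇒converges; r-approximant)

lemma4p3 : ConvergesToSqrt2Minus1 (λ n → r n 1ℚ)
lemma4p3 = approximants⇒converges (λ n → r n 1ℚ) r-approximant
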